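{- Let $p$ be a prime and let $h_1,\dots,h_d$ be (not necessarily distinct) $p$-expressions over variables $x_1,\dots,x_n$. Then the product $h_1\cdot h_2\cdots h_d$, viewed as a function from $\mathbb Z_p^n$ to $\mathbb{C}$ (with multiplication of real numbers), is a real linear combination of the functions in $\mathcal F_{n-1}$.
   Context: $\oplus$ denotes addition modulo $p$. A $p$-expression over $x_1,\dots,x_n$ is a function $\mathbb Z_p^n\to\mathbb{R}$ of the form $(x_1,\dots,x_n)\mapsto\alpha_1x_1\oplus\dots\oplus\alpha_nx_n\oplus\beta$, $\alpha_i,\beta\in\mathbb Z_p$, whose value in $\{0,\dots,p-1\}$ is regarded as a real number. For $0\le\ell\le n-1$, $F_\ell$ is the set of $p$-expressions $\alpha_1x_1\oplus\dots\oplus\alpha_\ell x_\ell\oplus x_{\ell+1}\oplus\beta$ with $\alpha_i\in\{0,\dots,p-1\}$, $\beta\in\{0,\dots,p-2\}$, and $\mathcal F_{n-1}=F_{n-1}\cup\dots\cup F_0\cup\{1\}$, $1$ the constant function. -}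

module Defs where

open import Data.Nat using (ℕ; zero; suc; _+_; _*_; _<_; NonZero)
open import Data.Nat.DivMod using (_%_)
open import Data.Nat.Properties using (<⇒≤)
open import Data.Fin using (Fin; toℕ; inject≤; fromℕ<)
import Data.Fin as Fin
open import Data.Integer using (+_)
open import Data.Rational using (ℚ; _/_; 0ℚ; 1ℚ) renaming (_+_ to _+ℚ_; _*_ to _*ℚ_)
open import Data.List using (List; []; _∷_)
open import Data.Product using (_×_; _,_)

Σℕ : (k : ℕ) → (Fin k → ℕ) → ℕ
Σℕ zero    f = 0
Σℕ (suc k) f = f Fin.zero + Σℕ k (λ i → f (Fin.suc i))

Πℚ : (k : ℕ) → (Fin k → ℚ) → ℚ
Πℚ zero    f = 1ℚ
Πℚ (suc k) f = f Fin.zero *ℚ Πℚ k (λ i → f (Fin.suc i))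

ℕ→ℚ : ℕ → ℚ
ℕ→ℚ k = (+ k) / 1

Point : ℕ → ℕ → Set
Point p n = Fin n → Fin p

-- a p-expression α₁x₁ ⊕ … ⊕ αₙxₙ ⊕ β over n variables
record PExpr (p n : ℕ) : Set where
  constructor pexpr
  field
    α : Fin n → Fin p
    β : Fin p

evalP : ∀ {p n} → .{{NonZero p}} → PExpr p n → Point p n → ℚ
evalP {p} {n} (pexpr α β) x =
  ℕ→ℚ ((Σℕ n (λ i → toℕ (α i) * toℕ (x i)) + toℕ β) % p)

-- elements of 𝓕_{n-1} = F_{n-1} ∪ … ∪ F_0 ∪ {1}
-- lin ℓ _ α β _ is α₁x₁ ⊕ … ⊕ α_ℓ x_ℓ ⊕ x_{ℓ+1} ⊕ β with 0 ≤ ℓ ≤ n-1, β ≤ p-2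
data FElem (p n : ℕ) : Set where
  one : FElem p n
  lin : (ℓ : ℕ) → (ℓ<n : ℓ < n) → (α : Fin ℓ → Fin p) → (β : Fin p)
      → suc (toℕ β) < p → FElem p n

evalF : ∀ {p n} → .{{NonZero p}} → FElem p n → Point p n → ℚ
evalF one x = 1ℚ
evalF {p} {n} (lin ℓ ℓ<n α β _) x =
  ℕ→ℚ ((Σℕ ℓ (λ i → toℕ (α i) * toℕ (x (inject≤ i (<⇒≤ ℓ<n))))
        + toℕ (x (fromℕ< ℓ<n)) + toℕ β) % p)

evalLC : ∀ {p n} → .{{NonZero p}} → List (ℚ × FElem p n) → Point p n → ℚ
evalLC []            x = 0ℚ
evalLC ((c , f) ∷ L) x = c *ℚ evalF f x +ℚ evalLC L x

module Submission where

-- The functions of 𝓕_{n-1} span all functions ℤ_p^n → ℚ, so any product of p-expressions is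
-- in their span. Spanning is proved by induction on n: writing x = (y, x′), every f is
-- ∑_t [y = t]·f(t, x′), so it suffices that [y = t]·φ(L x′ mod p) is in the span for each form
-- L of 𝓕 and each φ. A single form is handled through (L ⊕ b) + 1 − (L ⊕ (b+1)) = p·[L ⊕ (b+1) = 0],
-- which isolates the indicators of the values of L. For the product with [y = t], primality of p
-- makes k ↦ X ⊕ k(y − t) a bijection of ℤ_p when y ≠ t, whence
--   p·[X = u]·[y = t] = ∑_k [X ⊕ k(y − t) = u] + [y = t] − 1,
-- and each summand is a function of the 𝓕-form k·y + L(x′).

open import Defs

open import Data.Fin as Fin using (Fin; toℕ; fromℕ<; inject≤)
import Data.Fin.Properties as Fin
import Data.Integer as ℤ
import Data.Integer.Properties as ℤ
open import Data.List using (List; []; _∷_; _++_; map)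
open import Data.Nat as ℕ using (ℕ; zero; suc; _<_; _≤_; z≤n; s≤s; NonZero)
open import Data.Nat.Coprimality as Coprime using (1-coprimeTo)
open import Data.Nat.DivMod
open import Data.Nat.Divisibility using (_∣_; divides; ∣m+n∣m⇒∣n; n∣m*n; >⇒∤; m%n≡0⇒n∣m)
open import Data.Nat.Primality using (Prime; euclidsLemma; prime⇒nonTrivial)
import Data.Nat.Properties as ℕ
open import Data.Nat.Solver using () renaming (module +-*-Solver to ℕ-Solver)
open import Data.Product using (_×_; _,_; ∃; map₁; proj₁; proj₂)
open import Data.Rational using (ℚ; mkℚ; fromℚᵘ; 0ℚ; 1ℚ; _+_; _*_; -_; _-_; 1/_)
open import Data.Rational.Properties as ℚ
  using (toℚᵘ-injective; toℚᵘ-fromℚᵘ; toℚᵘ-homo-+; fromℚᵘ-cong)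
open import Algebra.Properties.Ring ℚ.+-*-ring using (-1*x≈-x)
open import Data.Rational.Solver using (module +-*-Solver)
import Data.Rational.Unnormalised as ℚᵘ
import Data.Rational.Unnormalised.Properties as ℚᵘ
open import Data.Sum using (inj₁; inj₂)
open import Data.Vec.Functional as Vector using (head; tail)
open import Function using (_∘_; _⇔_; mk⇔; Equivalence)
open import Function.Definitions using (Injective)
open import Relation.Binary.Core using (_Preserves_⟶_)
open import Relation.Binary.PropositionalEquality
open import Relation.Nullary using (¬_; yes; no; contradiction)
open ≡-Reasoning

fromℚᵘ-homo-+ : ∀ p q → fromℚᵘ (p ℚᵘ.+ q) ≡ fromℚᵘ p + fromℚᵘ q
fromℚᵘ-homo-+ p q = toℚᵘ-injective (ℚᵘ.≃-trans (toℚᵘ-fromℚᵘ (p ℚᵘ.+ q))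
  (ℚᵘ.≃-sym (ℚᵘ.≃-trans (toℚᵘ-homo-+ (fromℚᵘ p) (fromℚᵘ q))
    (ℚᵘ.+-cong (toℚᵘ-fromℚᵘ p) (toℚᵘ-fromℚᵘ q)))))

-- ℕ→ℚ k = (+ k) / 1 reduces to fromℚᵘ (ℕ→ℚᵘ k), so ℕ→ℚ inherits additivity from fromℚᵘ.
ℕ→ℚᵘ : ℕ → ℚᵘ.ℚᵘ
ℕ→ℚᵘ k = ℚᵘ.mkℚᵘ (ℤ.+ k) 0

ℕ→ℚ-homo-+ : ∀ m n → ℕ→ℚ (m ℕ.+ n) ≡ ℕ→ℚ m + ℕ→ℚ n
ℕ→ℚ-homo-+ m n =
  trans (fromℚᵘ-cong {ℕ→ℚᵘ (m ℕ.+ n)} {ℕ→ℚᵘ m ℚᵘ.+ ℕ→ℚᵘ n} (ℚᵘ.*≡* eq))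
        (fromℚᵘ-homo-+ (ℕ→ℚᵘ m) (ℕ→ℚᵘ n))
  where
  eq : ℤ.+ (m ℕ.+ n) ℤ.* ℤ.1ℤ ≡ (ℤ.+ m ℤ.* ℤ.1ℤ ℤ.+ ℤ.+ n ℤ.* ℤ.1ℤ) ℤ.* ℤ.1ℤ
  eq rewrite ℤ.*-identityʳ (ℤ.+ m) | ℤ.*-identityʳ (ℤ.+ n) | ℤ.*-identityʳ (ℤ.+ m ℤ.+ ℤ.+ n) = ℤ.pos-+ m n

ℕ→ℚ-suc : ∀ m → ℕ→ℚ (suc m) ≡ 1ℚ + ℕ→ℚ m
ℕ→ℚ-suc = ℕ→ℚ-homo-+ 1

Σℕ-cong : ∀ k {f g : Fin k → ℕ} → f ≗ g → Σℕ k f ≡ Σℕ k g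
Σℕ-cong zero    f≗g = refl
Σℕ-cong (suc k) f≗g = cong₂ ℕ._+_ (f≗g Fin.zero) (Σℕ-cong k (f≗g ∘ Fin.suc))

Πℚ-cong : ∀ k {f g : Fin k → ℚ} → f ≗ g → Πℚ k f ≡ Πℚ k g
Πℚ-cong zero    f≗g = refl
Πℚ-cong (suc k) f≗g = cong₂ _*_ (f≗g Fin.zero) (Πℚ-cong k (f≗g ∘ Fin.suc))

∑ : ℕ → (ℕ → ℚ) → ℚ
∑ zero    f = 0ℚ
∑ (suc K) f = f 0 + ∑ K (λ k → f (suc k))

∑-cong : ∀ K {f g : ℕ → ℚ} → (∀ k → k < K → f k ≡ g k) → ∑ K f ≡ ∑ K g
∑-cong zero    f≡g = refl
∑-cong (suc K) f≡g = cong₂ _+_ (f≡g 0 (s≤s z≤n)) (∑-cong K (λ k k<K → f≡g (suc k) (s≤s k<K)))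

∑-const : ∀ K c → ∑ K (λ _ → c) ≡ ℕ→ℚ K * c
∑-const zero    c = sym (ℚ.*-zeroˡ c)
∑-const (suc K) c = begin
  c + ∑ K (λ _ → c)      ≡⟨ cong₂ _+_ (sym (ℚ.*-identityˡ c)) (∑-const K c) ⟩
  1ℚ * c + ℕ→ℚ K * c     ≡⟨ ℚ.*-distribʳ-+ c 1ℚ (ℕ→ℚ K) ⟨
  (1ℚ + ℕ→ℚ K) * c       ≡⟨ cong (_* c) (ℕ→ℚ-suc K) ⟨
  ℕ→ℚ (suc K) * c        ∎

∑-zero : ∀ K {f : ℕ → ℚ} → (∀ k → k < K → f k ≡ 0ℚ) → ∑ K f ≡ 0ℚ
∑-zero K f≡0 = trans (∑-cong K f≡0) (trans (∑-const K 0ℚ) (ℚ.*-zeroʳ (ℕ→ℚ K)))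

∑-single : ∀ K {f : ℕ → ℚ} z → z < K → (∀ k → k < K → k ≢ z → f k ≡ 0ℚ) → ∑ K f ≡ f z
∑-single (suc K) {f} zero _ f≡0 = begin
  f 0 + ∑ K (λ k → f (suc k)) ≡⟨ cong (f 0 +_) (∑-zero K (λ k k<K → f≡0 (suc k) (s≤s k<K) λ ())) ⟩
  f 0 + 0ℚ                    ≡⟨ ℚ.+-identityʳ (f 0) ⟩
  f 0                         ∎
∑-single (suc K) {f} (suc z) (s≤s z<K) f≡0 = begin
  f 0 + ∑ K (λ k → f (suc k)) ≡⟨ cong₂ _+_ (f≡0 0 (s≤s z≤n) λ ())
                                          (∑-single K z z<K λ k k<K k≢z → f≡0 (suc k) (s≤s k<K) (k≢z ∘ ℕ.suc-injective)) ⟩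
  0ℚ + f (suc z)              ≡⟨ ℚ.+-identityˡ (f (suc z)) ⟩
  f (suc z)                   ∎

𝟙[_≡_] : ℕ → ℕ → ℚ
𝟙[ a ≡ b ] with a ℕ.≟ b
... | yes _ = 1ℚ
... | no _  = 0ℚ

𝟙-≡ : ∀ {a b} → a ≡ b → 𝟙[ a ≡ b ] ≡ 1ℚ
𝟙-≡ {a} {b} a≡b with a ℕ.≟ b
... | yes _  = refl
... | no a≢b = contradiction a≡b a≢b

𝟙-≢ : ∀ {a b} → a ≢ b → 𝟙[ a ≡ b ] ≡ 0ℚ
𝟙-≢ {a} {b} a≢b with a ℕ.≟ b
... | yes a≡b = contradiction a≡b a≢b
... | no _    = refl

𝟙-cong : ∀ {a b c d} → a ≡ b ⇔ c ≡ d → 𝟙[ a ≡ b ] ≡ 𝟙[ c ≡ d ]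
𝟙-cong {a} {b} {c} {d} a≡b⇔c≡d with a ℕ.≟ b
... | yes a≡b = sym (𝟙-≡ (Equivalence.to a≡b⇔c≡d a≡b))
... | no a≢b  = sym (𝟙-≢ (a≢b ∘ Equivalence.from a≡b⇔c≡d))

∑-split₂ : ∀ K (f : ℕ → ℚ) → 1 < K → ∑ K f ≡ f 0 + (f 1 + ∑ (K ℕ.∸ 2) (λ r → f (2 ℕ.+ r)))
∑-split₂ (suc (suc K)) f _ = refl
∑-split₂ (suc zero) f (s≤s ())

∑-sift : ∀ K z (h : ℕ → ℚ) → z < K → ∑ K (λ k → 𝟙[ z ≡ k ] * h k) ≡ h z
∑-sift K z h z<K = begin
  ∑ K (λ k → 𝟙[ z ≡ k ] * h k) ≡⟨ ∑-single K z z<K (λ k _ k≢z →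
                                    trans (cong (_* h k) (𝟙-≢ (k≢z ∘ sym))) (ℚ.*-zeroˡ (h k))) ⟩
  𝟙[ z ≡ z ] * h z             ≡⟨ cong (_* h z) (𝟙-≡ {z} refl) ⟩
  1ℚ * h z                     ≡⟨ ℚ.*-identityˡ (h z) ⟩
  h z                          ∎

∑-𝟙-unique : ∀ K (f : ℕ → ℕ) u k₀ → k₀ < K → f k₀ ≡ u → (∀ k → k < K → f k ≡ u → k ≡ k₀)
           → ∑ K (λ k → 𝟙[ f k ≡ u ]) ≡ 1ℚ
∑-𝟙-unique K f u k₀ k₀<K fk₀≡u unique =
  trans (∑-single K k₀ k₀<K (λ k k<K k≢k₀ → 𝟙-≢ (k≢k₀ ∘ unique k k<K))) (𝟙-≡ fk₀≡u)

injective⇒surjective : ∀ {m} (f : Fin m → Fin m) → Injective _≡_ _≡_ f → ∀ j → ∃ λ i → f i ≡ j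
injective⇒surjective {suc m} f f-inj j with Fin.any? (λ i → f i Fin.≟ j)
... | yes hit = hit
... | no miss = contradiction (Fin.injective⇒≤ punchOut-inj) ℕ.1+n≰n
  where
  j≢f : ∀ i → j ≢ f i
  j≢f i j≡fi = miss (i , sym j≡fi)
  punchOut-inj : Injective _≡_ _≡_ (λ i → Fin.punchOut (j≢f i))
  punchOut-inj eq = f-inj (Fin.punchOut-injective (j≢f _) (j≢f _) eq)

module _ {p : ℕ} .{{_ : NonZero p}} where

  [m%n+o]%n≡[m+o]%n : ∀ m o → (m % p ℕ.+ o) % p ≡ (m ℕ.+ o) % p
  [m%n+o]%n≡[m+o]%n m o = begin
    (m % p ℕ.+ o) % p          ≡⟨ %-distribˡ-+ (m % p) o p ⟩
    (m % p % p ℕ.+ o % p) % p  ≡⟨ cong (λ r → (r ℕ.+ o % p) % p) (m%n%n≡m%n m p) ⟩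
    (m % p ℕ.+ o % p) % p      ≡⟨ %-distribˡ-+ m o p ⟨
    (m ℕ.+ o) % p              ∎

  [m+n]%d≡m%d⇒d∣n : ∀ m n → (m ℕ.+ n) % p ≡ m % p → p ∣ n
  [m+n]%d≡m%d⇒d∣n m n eq = ∣m+n∣m⇒∣n (divides ((m ℕ.+ n) / p) (ℕ.+-cancelˡ-≡ (m % p) _ _ split)) (n∣m*n (m / p))
    where
    split : m % p ℕ.+ (m / p ℕ.* p ℕ.+ n) ≡ m % p ℕ.+ (m ℕ.+ n) / p ℕ.* p
    split = begin
      m % p ℕ.+ (m / p ℕ.* p ℕ.+ n)  ≡⟨ ℕ.+-assoc (m % p) _ n ⟨
      m % p ℕ.+ m / p ℕ.* p ℕ.+ n    ≡⟨ cong (ℕ._+ n) (m≡m%n+[m/n]*n m p) ⟨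
      m ℕ.+ n                        ≡⟨ m≡m%n+[m/n]*n (m ℕ.+ n) p ⟩
      (m ℕ.+ n) % p ℕ.+ (m ℕ.+ n) / p ℕ.* p  ≡⟨ cong (ℕ._+ (m ℕ.+ n) / p ℕ.* p) eq ⟩
      m % p ℕ.+ (m ℕ.+ n) / p ℕ.* p  ∎

  ∣∧<⇒≡0 : ∀ {m} → p ∣ m → m < p → m ≡ 0
  ∣∧<⇒≡0 {zero}  _   _   = refl
  ∣∧<⇒≡0 {suc m} p∣m m<p = contradiction p∣m (>⇒∤ m<p)

  ∣y+c∧t+c≡p⇒y≡t : ∀ {y t c} → y < p → t < p → t ℕ.+ c ≡ p → p ∣ y ℕ.+ c → y ≡ t
  ∣y+c∧t+c≡p⇒y≡t {y} {t} {c} y<p t<p t+c≡p p∣y+c = begin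
    y                        ≡⟨ m<n⇒m%n≡m y<p ⟨
    y % p                    ≡⟨ [m+n]%n≡m%n y p ⟨
    (y ℕ.+ p) % p            ≡⟨ cong (λ w → (y ℕ.+ w) % p) t+c≡p ⟨
    (y ℕ.+ (t ℕ.+ c)) % p    ≡⟨ cong (_% p) (ℕ.+-comm y (t ℕ.+ c)) ⟩
    (t ℕ.+ c ℕ.+ y) % p      ≡⟨ cong (_% p) (ℕ.+-assoc t c y) ⟩
    (t ℕ.+ (c ℕ.+ y)) % p    ≡⟨ %-remove-+ʳ t (subst (p ∣_) (ℕ.+-comm y c) p∣y+c) ⟩
    t % p                    ≡⟨ m<n⇒m%n≡m t<p ⟩
    t                        ∎

  [1+m]%n≡[1+m%n]%n : ∀ m → suc m % p ≡ suc (m % p) % p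
  [1+m]%n≡[1+m%n]%n m = begin
    suc m % p                          ≡⟨ cong (λ w → suc w % p) (m≡m%n+[m/n]*n m p) ⟩
    (suc (m % p) ℕ.+ m / p ℕ.* p) % p  ≡⟨ [m+kn]%n≡m%n (suc (m % p)) (m / p) p ⟩
    suc (m % p) % p                    ∎

  carry : ∀ m → ℕ→ℚ (m % p) + 1ℚ ≡ ℕ→ℚ (suc m % p) + ℕ→ℚ p * 𝟙[ suc m % p ≡ 0 ]
  carry m with ℕ.m≤n⇒m<n∨m≡n (m%n<n m p)
  ... | inj₁ no-wrap = begin
    ℕ→ℚ (m % p) + 1ℚ                              ≡⟨ ℚ.+-comm (ℕ→ℚ (m % p)) 1ℚ ⟩
    1ℚ + ℕ→ℚ (m % p)                              ≡⟨ ℕ→ℚ-suc (m % p) ⟨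
    ℕ→ℚ (suc (m % p))                             ≡⟨ cong ℕ→ℚ step ⟨
    ℕ→ℚ (suc m % p)                               ≡⟨ ℚ.+-identityʳ _ ⟨
    ℕ→ℚ (suc m % p) + 0ℚ                          ≡⟨ cong (ℕ→ℚ (suc m % p) +_) (ℚ.*-zeroʳ (ℕ→ℚ p)) ⟨
    ℕ→ℚ (suc m % p) + ℕ→ℚ p * 0ℚ                  ≡⟨ cong (λ i → ℕ→ℚ (suc m % p) + ℕ→ℚ p * i) (𝟙-≢ λ eq → ℕ.1+n≢0 (trans (sym step) eq)) ⟨
    ℕ→ℚ (suc m % p) + ℕ→ℚ p * 𝟙[ suc m % p ≡ 0 ]  ∎
    where
    step : suc m % p ≡ suc (m % p)
    step = trans ([1+m]%n≡[1+m%n]%n m) (m<n⇒m%n≡m no-wrap)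
  ... | inj₂ wrap = begin
    ℕ→ℚ (m % p) + 1ℚ                              ≡⟨ ℚ.+-comm (ℕ→ℚ (m % p)) 1ℚ ⟩
    1ℚ + ℕ→ℚ (m % p)                              ≡⟨ ℕ→ℚ-suc (m % p) ⟨
    ℕ→ℚ (suc (m % p))                             ≡⟨ cong ℕ→ℚ wrap ⟩
    ℕ→ℚ p                                         ≡⟨ ℚ.*-identityʳ (ℕ→ℚ p) ⟨
    ℕ→ℚ p * 1ℚ                                    ≡⟨ ℚ.+-identityˡ _ ⟨
    0ℚ + ℕ→ℚ p * 1ℚ                               ≡⟨ cong₂ (λ r i → ℕ→ℚ r + ℕ→ℚ p * i) step (𝟙-≡ step) ⟨
    ℕ→ℚ (suc m % p) + ℕ→ℚ p * 𝟙[ suc m % p ≡ 0 ]  ∎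
    where
    step : suc m % p ≡ 0
    step = trans ([1+m]%n≡[1+m%n]%n m) (trans (cong (_% p) wrap) (n%n≡0 p))

  InSpan : ∀ {n} → (Point p n → ℚ) → Set
  InSpan {n} f = ∃ λ (L : List (ℚ × FElem p n)) → ∀ x → f x ≡ evalLC L x

  evalLC-++ : ∀ {n} (L M : List (ℚ × FElem p n)) x → evalLC (L ++ M) x ≡ evalLC L x + evalLC M x
  evalLC-++ []            M x = sym (ℚ.+-identityˡ (evalLC M x))
  evalLC-++ ((c , e) ∷ L) M x = trans (cong (c * evalF e x +_) (evalLC-++ L M x))
                                      (sym (ℚ.+-assoc (c * evalF e x) (evalLC L x) (evalLC M x)))

  evalLC-scale : ∀ {n} c (L : List (ℚ × FElem p n)) x → evalLC (map (map₁ (c *_)) L) x ≡ c * evalLC L x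
  evalLC-scale c []            x = sym (ℚ.*-zeroʳ c)
  evalLC-scale c ((d , e) ∷ L) x = begin
    c * d * evalF e x + evalLC (map (map₁ (c *_)) L) x  ≡⟨ cong₂ _+_ (ℚ.*-assoc c d (evalF e x)) (evalLC-scale c L x) ⟩
    c * (d * evalF e x) + c * evalLC L x                ≡⟨ ℚ.*-distribˡ-+ c (d * evalF e x) (evalLC L x) ⟨
    c * (d * evalF e x + evalLC L x)                    ∎

  span-resp : ∀ {n} {f g : Point p n → ℚ} → (∀ x → g x ≡ f x) → InSpan f → InSpan g
  span-resp g≡f (L , f≡L) = L , λ x → trans (g≡f x) (f≡L x)

  span-𝓕 : ∀ {n} (e : FElem p n) → InSpan (evalF e)
  span-𝓕 e = (1ℚ , e) ∷ [] , λ x → sym (trans (ℚ.+-identityʳ _) (ℚ.*-identityˡ (evalF e x)))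

  span-0 : ∀ {n} → InSpan {n} (λ _ → 0ℚ)
  span-0 = [] , λ _ → refl

  span-+ : ∀ {n} {f g : Point p n → ℚ} → InSpan f → InSpan g → InSpan (λ x → f x + g x)
  span-+ (L , f≡L) (M , g≡M) = L ++ M , λ x → trans (cong₂ _+_ (f≡L x) (g≡M x)) (sym (evalLC-++ L M x))

  span-scale : ∀ {n} c {f : Point p n → ℚ} → InSpan f → InSpan (λ x → c * f x)
  span-scale c (L , f≡L) = map (map₁ (c *_)) L , λ x → trans (cong (c *_) (f≡L x)) (sym (evalLC-scale c L x))

  span-const : ∀ {n} c → InSpan {n} (λ _ → c)
  span-const c = span-resp (λ _ → sym (ℚ.*-identityʳ c)) (span-scale c (span-𝓕 one))

  span-- : ∀ {n} {f g : Point p n → ℚ} → InSpan f → InSpan g → InSpan (λ x → f x - g x)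
  span-- {g = g} f∈ g∈ = span-+ f∈ (span-resp (λ x → sym (-1*x≈-x (g x))) (span-scale (- 1ℚ) g∈))

  span-∑ : ∀ {n} K (F : ℕ → Point p n → ℚ) → (∀ k → k < K → InSpan (F k)) → InSpan (λ x → ∑ K (λ k → F k x))
  span-∑ zero    F F∈ = span-0
  span-∑ (suc K) F F∈ = span-+ (F∈ 0 (s≤s z≤n)) (span-∑ K (F ∘ suc) (λ k k<K → F∈ (suc k) (s≤s k<K)))

  evalP-resp : ∀ {n} (e : PExpr p n) → evalP e Preserves _≗_ ⟶ _≡_
  evalP-resp {n} (pexpr α β) x≗y =
    cong (λ s → ℕ→ℚ ((s ℕ.+ toℕ β) % p)) (Σℕ-cong n λ i → cong (λ a → toℕ (α i) ℕ.* toℕ a) (x≗y i))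

  linForm : ∀ {n ℓ} → ℓ < n → (Fin ℓ → Fin p) → Point p n → ℕ
  linForm {ℓ = ℓ} ℓ<n α x =
    Σℕ ℓ (λ i → toℕ (α i) ℕ.* toℕ (x (inject≤ i (ℕ.<⇒≤ ℓ<n)))) ℕ.+ toℕ (x (fromℕ< ℓ<n))

  linForm-∷ : ∀ {n ℓ} (ℓ<n : ℓ < n) a α (x : Point p (suc n))
            → linForm (s≤s ℓ<n) (a Vector.∷ α) x ≡ toℕ a ℕ.* toℕ (head x) ℕ.+ linForm ℓ<n α (tail x)
  linForm-∷ ℓ<n a α x = ℕ.+-assoc (toℕ a ℕ.* toℕ (head x)) _ _

  private
    pℚ : ℚ
    pℚ = mkℚ (ℤ.+ p) 0 (Coprime.sym (1-coprimeTo p))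

  p⁻¹ : ℚ
  p⁻¹ = 1/ pℚ

  p⁻¹*p≡1 : p⁻¹ * ℕ→ℚ p ≡ 1ℚ
  p⁻¹*p≡1 = trans (cong (p⁻¹ *_) (ℚ.normalize-coprime {p} {0} (Coprime.sym (1-coprimeTo p)))) (ℚ.*-inverseˡ pℚ)

  isolate : ∀ a b i → a ≡ b + ℕ→ℚ p * i → i ≡ p⁻¹ * (a - b)
  isolate a b i a≡b+pi = begin
    i                               ≡⟨ ℚ.*-identityˡ i ⟨
    1ℚ * i                          ≡⟨ cong (_* i) p⁻¹*p≡1 ⟨
    p⁻¹ * ℕ→ℚ p * i                 ≡⟨ cancel p⁻¹ (ℕ→ℚ p) i b ⟩
    p⁻¹ * ((b + ℕ→ℚ p * i) - b)     ≡⟨ cong (λ w → p⁻¹ * (w - b)) a≡b+pi ⟨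
    p⁻¹ * (a - b)                   ∎
    where
    open +-*-Solver
    cancel : ∀ q P i b → q * P * i ≡ q * ((b + P * i) - b)
    cancel = solve 4 (λ q P i b → q :* P :* i := q :* ((b :+ P :* i) :- b)) refl

  module _ (p-prime : Prime p) where

    1<p : 1 < p
    1<p = ℕ.nonTrivial⇒n>1 p {{prime⇒nonTrivial p-prime}}

    affine-injective-≤ : ∀ X d {k₁ k₂} → ¬ p ∣ d → k₁ ≤ k₂ → k₂ < p
                       → (X ℕ.+ k₁ ℕ.* d) % p ≡ (X ℕ.+ k₂ ℕ.* d) % p → k₁ ≡ k₂
    affine-injective-≤ X d {k₁} {k₂} p∤d k₁≤k₂ k₂<p eq = begin
      k₁                 ≡⟨ ℕ.+-identityʳ k₁ ⟨
      k₁ ℕ.+ 0           ≡⟨ cong (k₁ ℕ.+_) m≡0 ⟨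
      k₁ ℕ.+ (k₂ ℕ.∸ k₁) ≡⟨ ℕ.m+[n∸m]≡n k₁≤k₂ ⟩
      k₂                 ∎
      where
      m = k₂ ℕ.∸ k₁
      split : X ℕ.+ k₂ ℕ.* d ≡ X ℕ.+ k₁ ℕ.* d ℕ.+ m ℕ.* d
      split = begin
        X ℕ.+ k₂ ℕ.* d                 ≡⟨ cong (λ k → X ℕ.+ k ℕ.* d) (ℕ.m+[n∸m]≡n k₁≤k₂) ⟨
        X ℕ.+ (k₁ ℕ.+ m) ℕ.* d         ≡⟨ cong (X ℕ.+_) (ℕ.*-distribʳ-+ d k₁ m) ⟩
        X ℕ.+ (k₁ ℕ.* d ℕ.+ m ℕ.* d)   ≡⟨ ℕ.+-assoc X (k₁ ℕ.* d) (m ℕ.* d) ⟨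
        X ℕ.+ k₁ ℕ.* d ℕ.+ m ℕ.* d     ∎
      m≡0 : m ≡ 0
      m≡0 with euclidsLemma m d p-prime ([m+n]%d≡m%d⇒d∣n _ _ (trans (cong (_% p) (sym split)) (sym eq)))
      ... | inj₁ p∣m = ∣∧<⇒≡0 p∣m (ℕ.≤-<-trans (ℕ.m∸n≤m k₂ k₁) k₂<p)
      ... | inj₂ p∣d = contradiction p∣d p∤d

    affine-injective : ∀ X d {k₁ k₂} → ¬ p ∣ d → k₁ < p → k₂ < p
                     → (X ℕ.+ k₁ ℕ.* d) % p ≡ (X ℕ.+ k₂ ℕ.* d) % p → k₁ ≡ k₂
    affine-injective X d {k₁} {k₂} p∤d k₁<p k₂<p eq with ℕ.≤-total k₁ k₂
    ... | inj₁ k₁≤k₂ = affine-injective-≤ X d p∤d k₁≤k₂ k₂<p eq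
    ... | inj₂ k₂≤k₁ = sym (affine-injective-≤ X d p∤d k₂≤k₁ k₁<p (sym eq))

    affine-surjective : ∀ X d {u} → ¬ p ∣ d → u < p → ∃ λ k → k < p × (X ℕ.+ k ℕ.* d) % p ≡ u
    affine-surjective X d {u} p∤d u<p =
      let i , line-i≡u = injective⇒surjective line line-injective (fromℕ< u<p)
      in toℕ i , Fin.toℕ<n i , (begin
           (X ℕ.+ toℕ i ℕ.* d) % p  ≡⟨ toℕ-line i ⟨
           toℕ (line i)             ≡⟨ cong toℕ line-i≡u ⟩
           toℕ (fromℕ< u<p)         ≡⟨ Fin.toℕ-fromℕ< u<p ⟩
           u                        ∎)
      where
      line : Fin p → Fin p
      line i = (X ℕ.+ toℕ i ℕ.* d) mod p
      toℕ-line : ∀ i → toℕ (line i) ≡ (X ℕ.+ toℕ i ℕ.* d) % p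
      toℕ-line i = Fin.toℕ-fromℕ< (m%n<n _ p)
      line-injective : Injective _≡_ _≡_ line
      line-injective {i} {j} eq = Fin.toℕ-injective (affine-injective X d p∤d (Fin.toℕ<n i) (Fin.toℕ<n j)
        (trans (sym (toℕ-line i)) (trans (cong toℕ eq) (toℕ-line j))))

    module _ {n ℓ} (ℓ<n : ℓ < n) (α : Fin ℓ → Fin p) where

      span-shift : ∀ b → suc b < p → InSpan (λ x → ℕ→ℚ ((linForm ℓ<n α x ℕ.+ b) % p))
      span-shift b 1+b<p = span-resp (λ x → cong (λ β → ℕ→ℚ ((linForm ℓ<n α x ℕ.+ β) % p)) (sym toℕ-β))
                                      (span-𝓕 (lin ℓ ℓ<n α β (subst (λ b → suc b < p) (sym toℕ-β) 1+b<p)))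
        where
        β = fromℕ< (ℕ.<-trans (ℕ.n<1+n b) 1+b<p)
        toℕ-β : toℕ β ≡ b
        toℕ-β = Fin.toℕ-fromℕ< _

      span-𝟙-wrap : ∀ b → suc (suc b) < p → InSpan (λ x → 𝟙[ (linForm ℓ<n α x ℕ.+ suc b) % p ≡ 0 ])
      span-𝟙-wrap b 2+b<p = span-resp identity
        (span-scale p⁻¹ (span-- (span-+ (span-shift b (ℕ.<-trans (ℕ.n<1+n (suc b)) 2+b<p)) (span-const 1ℚ))
                                (span-shift (suc b) 2+b<p)))
        where
        identity : ∀ x → 𝟙[ (linForm ℓ<n α x ℕ.+ suc b) % p ≡ 0 ]
                       ≡ p⁻¹ * (ℕ→ℚ ((linForm ℓ<n α x ℕ.+ b) % p) + 1ℚ - ℕ→ℚ ((linForm ℓ<n α x ℕ.+ suc b) % p))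
        identity x rewrite ℕ.+-suc (linForm ℓ<n α x) b = isolate _ _ _ (carry (linForm ℓ<n α x ℕ.+ b))

      span-𝟙-high : ∀ {s b} → s ℕ.+ suc b ≡ p → 1 < s → InSpan (λ x → 𝟙[ linForm ℓ<n α x % p ≡ s ])
      span-𝟙-high {s} {b} s+1+b≡p 1<s = span-resp (λ x → 𝟙-cong (wrap⇔ x)) (span-𝟙-wrap b 2+b<p)
        where
        2+b<p : suc (suc b) < p
        2+b<p = subst (suc (suc b) <_) s+1+b≡p (ℕ.+-monoˡ-≤ (suc b) 1<s)
        wrap⇔ : ∀ x → linForm ℓ<n α x % p ≡ s ⇔ (linForm ℓ<n α x ℕ.+ suc b) % p ≡ 0
        wrap⇔ x = mk⇔
          (λ z≡s → begin
            (L ℕ.+ suc b) % p      ≡⟨ [m%n+o]%n≡[m+o]%n L (suc b) ⟨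
            (L % p ℕ.+ suc b) % p  ≡⟨ cong (λ z → (z ℕ.+ suc b) % p) z≡s ⟩
            (s ℕ.+ suc b) % p      ≡⟨ cong (_% p) s+1+b≡p ⟩
            p % p                  ≡⟨ n%n≡0 p ⟩
            0                      ∎)
          (λ wraps → ∣y+c∧t+c≡p⇒y≡t (m%n<n L p) (subst (s <_) s+1+b≡p (ℕ.m<m+n s (s≤s z≤n))) s+1+b≡p
                       (m%n≡0⇒n∣m _ p (trans ([m%n+o]%n≡[m+o]%n L (suc b)) wraps)))
          where L = linForm ℓ<n α x

      private
        z : Point p n → ℕ
        z x = linForm ℓ<n α x % p

      span-𝟙-≥2 : ∀ r → 2 ℕ.+ r < p → InSpan (λ x → 𝟙[ z x ≡ 2 ℕ.+ r ])
      span-𝟙-≥2 r 2+r<p = span-𝟙-high (trans (ℕ.+-suc (2 ℕ.+ r) _) (ℕ.m+[n∸m]≡n 2+r<p)) (s≤s (s≤s z≤n))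

      high-terms : (ℕ → ℚ) → Point p n → ℚ
      high-terms h x = ∑ (p ℕ.∸ 2) (λ r → 𝟙[ z x ≡ 2 ℕ.+ r ] * h (2 ℕ.+ r))

      span-high-terms : ∀ h → InSpan (high-terms h)
      span-high-terms h = span-∑ (p ℕ.∸ 2) _ λ r r<p∸2 →
        span-resp (λ x → ℚ.*-comm _ (h (2 ℕ.+ r)))
                  (span-scale (h (2 ℕ.+ r)) (span-𝟙-≥2 r (subst (2 ℕ.+ r <_) (ℕ.m+[n∸m]≡n 1<p) (ℕ.+-monoʳ-< 2 r<p∸2))))

      sifted : ∀ h x → 𝟙[ z x ≡ 0 ] * h 0 + (𝟙[ z x ≡ 1 ] * h 1 + high-terms h x) ≡ h (z x)
      sifted h x = trans (sym (∑-split₂ p _ 1<p)) (∑-sift p (z x) h (m%n<n _ p))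

      -- Wrap-arounds only reach s ≥ 2, since the offset of an 𝓕-element is at most p − 2;
      -- the indicators of 0 and 1 are recovered from the sifting identities for h = id and h = 1.
      span-𝟙 : ∀ s → s < p → InSpan (λ x → 𝟙[ linForm ℓ<n α x % p ≡ s ])
      span-𝟙 (suc (suc r)) 2+r<p = span-𝟙-≥2 r 2+r<p
      span-𝟙 1             _     = span-resp (λ x → isolate₁ 𝟙[ z x ≡ 0 ] 𝟙[ z x ≡ 1 ] _ _ (sifted ℕ→ℚ x))
        (span-- (span-resp (λ x → cong (λ w → ℕ→ℚ (w % p)) (sym (ℕ.+-identityʳ _))) (span-shift 0 1<p))
                (span-high-terms ℕ→ℚ))
        where
        open +-*-Solver
        isolate₁ : ∀ a b S Z → a * 0ℚ + (b * 1ℚ + S) ≡ Z → b ≡ Z - S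
        isolate₁ a b S Z eq = trans (solve 3 (λ a b S → b := a :* con 0ℚ :+ (b :* con 1ℚ :+ S) :- S) refl a b S)
                                    (cong (_- S) eq)
      span-𝟙 0             _     = span-resp (λ x → isolate₀ 𝟙[ z x ≡ 0 ] 𝟙[ z x ≡ 1 ] _ (sifted (λ _ → 1ℚ) x))
        (span-- (span-- (span-const 1ℚ) (span-𝟙 1 1<p)) (span-high-terms (λ _ → 1ℚ)))
        where
        open +-*-Solver
        isolate₀ : ∀ a b S → a * 1ℚ + (b * 1ℚ + S) ≡ 1ℚ → a ≡ 1ℚ - b - S
        isolate₀ a b S eq = trans (solve 3 (λ a b S → a := a :* con 1ℚ :+ (b :* con 1ℚ :+ S) :- b :- S) refl a b S)
                                  (cong (λ w → w - b - S) eq)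

      span-∘linForm : ∀ (g : ℕ → ℚ) → InSpan (λ x → g (linForm ℓ<n α x % p))
      span-∘linForm g = span-resp (λ x → sym (∑-sift p (z x) g (m%n<n _ p)))
        (span-∑ p _ λ s s<p → span-resp (λ x → ℚ.*-comm _ (g s)) (span-scale (g s) (span-𝟙 s s<p)))

    span-𝟙-head : ∀ {n} t → InSpan {suc n} (λ x → 𝟙[ toℕ (head x) ≡ t ])
    span-𝟙-head t = span-resp (λ x → cong (λ w → 𝟙[ w ≡ t ]) (sym (m<n⇒m%n≡m (Fin.toℕ<n (head x)))))
                              (span-∘linForm (s≤s z≤n) (λ ()) (λ w → 𝟙[ w ≡ t ]))

    -- For y ≢ t the map k ↦ X + k (y - t) is a bijection of ℤ/p, so exactly one k hits u;
    -- for y ≡ t every k hits u exactly when X does.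
    ∑-𝟙-affine : ∀ {X y t u} → X < p → y < p → t < p → u < p
      → ∑ p (λ k → 𝟙[ (X ℕ.+ k ℕ.* (y ℕ.+ (p ℕ.∸ t))) % p ≡ u ]) + 𝟙[ y ≡ t ]
        ≡ 1ℚ + ℕ→ℚ p * (𝟙[ X ≡ u ] * 𝟙[ y ≡ t ])
    ∑-𝟙-affine {X} {y} {t} {u} X<p y<p t<p u<p with y ℕ.≟ t
    ... | yes refl = begin
      ∑ p (λ k → 𝟙[ (X ℕ.+ k ℕ.* (y ℕ.+ (p ℕ.∸ y))) % p ≡ u ]) + 1ℚ ≡⟨ cong₂ _+_ count refl ⟩
      ℕ→ℚ p * 𝟙[ X ≡ u ] + 1ℚ                                      ≡⟨ ℚ.+-comm (ℕ→ℚ p * 𝟙[ X ≡ u ]) 1ℚ ⟩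
      1ℚ + ℕ→ℚ p * 𝟙[ X ≡ u ]                                      ≡⟨ cong (λ i → 1ℚ + ℕ→ℚ p * i) (ℚ.*-identityʳ 𝟙[ X ≡ u ]) ⟨
      1ℚ + ℕ→ℚ p * (𝟙[ X ≡ u ] * 1ℚ)                               ∎
      where
      constant : ∀ k → (X ℕ.+ k ℕ.* (y ℕ.+ (p ℕ.∸ y))) % p ≡ X
      constant k = begin
        (X ℕ.+ k ℕ.* (y ℕ.+ (p ℕ.∸ y))) % p ≡⟨ cong (λ d → (X ℕ.+ k ℕ.* d) % p) (ℕ.m+[n∸m]≡n (ℕ.<⇒≤ y<p)) ⟩
        (X ℕ.+ k ℕ.* p) % p                 ≡⟨ [m+kn]%n≡m%n X k p ⟩
        X % p                               ≡⟨ m<n⇒m%n≡m X<p ⟩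
        X                                   ∎
      count : ∑ p (λ k → 𝟙[ (X ℕ.+ k ℕ.* (y ℕ.+ (p ℕ.∸ y))) % p ≡ u ]) ≡ ℕ→ℚ p * 𝟙[ X ≡ u ]
      count = trans (∑-cong p λ k _ → cong (λ w → 𝟙[ w ≡ u ]) (constant k)) (∑-const p 𝟙[ X ≡ u ])
    ... | no y≢t = begin
      ∑ p (λ k → 𝟙[ (X ℕ.+ k ℕ.* d) % p ≡ u ]) + 0ℚ ≡⟨ ℚ.+-identityʳ _ ⟩
      ∑ p (λ k → 𝟙[ (X ℕ.+ k ℕ.* d) % p ≡ u ])      ≡⟨ ∑-𝟙-unique p _ u k₀ k₀<p hit unique ⟩
      1ℚ                                           ≡⟨ ℚ.+-identityʳ 1ℚ ⟨
      1ℚ + 0ℚ                                      ≡⟨ cong (1ℚ +_) (trans (cong (ℕ→ℚ p *_) (ℚ.*-zeroʳ 𝟙[ X ≡ u ])) (ℚ.*-zeroʳ (ℕ→ℚ p))) ⟨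
      1ℚ + ℕ→ℚ p * (𝟙[ X ≡ u ] * 0ℚ)               ∎
      where
      d = y ℕ.+ (p ℕ.∸ t)
      p∤d : ¬ p ∣ d
      p∤d = y≢t ∘ ∣y+c∧t+c≡p⇒y≡t y<p t<p (ℕ.m+[n∸m]≡n (ℕ.<⇒≤ t<p))
      solution = affine-surjective X d p∤d u<p
      k₀ = proj₁ solution
      k₀<p = proj₁ (proj₂ solution)
      hit = proj₂ (proj₂ solution)
      unique : ∀ k → k < p → (X ℕ.+ k ℕ.* d) % p ≡ u → k ≡ k₀
      unique k k<p hit′ = affine-injective X d p∤d k<p k₀<p (trans hit′ (sym hit))

    span-𝟙-head*∘linForm : ∀ {n ℓ} (ℓ<n : ℓ < n) α (g : ℕ → ℚ) {t} → t < p
      → InSpan {suc n} (λ x → 𝟙[ toℕ (head x) ≡ t ] * g (linForm ℓ<n α (tail x) % p))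
    span-𝟙-head*∘linForm {n} ℓ<n α g {t} t<p = span-resp sifted-product
      (span-∑ p _ λ u u<p → span-scale (g u) (span-scale p⁻¹
        (span-- (span-+ (span-∑ p _ λ k k<p → span-sheared k<p u) (span-𝟙-head t)) (span-const 1ℚ))))
      where
      X : Point p (suc n) → ℕ
      X x = linForm ℓ<n α (tail x) % p
      d : Point p (suc n) → ℕ
      d x = toℕ (head x) ℕ.+ (p ℕ.∸ t)

      span-sheared : ∀ {k} → k < p → ∀ u → InSpan (λ x → 𝟙[ (X x ℕ.+ k ℕ.* d x) % p ≡ u ])
      span-sheared {k} k<p u = span-resp (λ x → cong (λ w → 𝟙[ w ≡ u ]) (shear x))
        (span-∘linForm (s≤s ℓ<n) (fromℕ< k<p Vector.∷ α) (λ w → 𝟙[ (w ℕ.+ k ℕ.* (p ℕ.∸ t)) % p ≡ u ]))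
        where
        open ℕ-Solver
        shear : ∀ x → (X x ℕ.+ k ℕ.* d x) % p ≡ (linForm (s≤s ℓ<n) (fromℕ< k<p Vector.∷ α) x % p ℕ.+ k ℕ.* (p ℕ.∸ t)) % p
        shear x = begin
          (L % p ℕ.+ k ℕ.* (y ℕ.+ c)) % p  ≡⟨ [m%n+o]%n≡[m+o]%n L _ ⟩
          (L ℕ.+ k ℕ.* (y ℕ.+ c)) % p      ≡⟨ cong (_% p) regroup ⟩
          (k ℕ.* y ℕ.+ L ℕ.+ k ℕ.* c) % p  ≡⟨ cong (λ w → (w ℕ.+ k ℕ.* c) % p) L′≡ky+L ⟨
          (L′ ℕ.+ k ℕ.* c) % p             ≡⟨ [m%n+o]%n≡[m+o]%n L′ _ ⟨
          (L′ % p ℕ.+ k ℕ.* c) % p         ∎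
          where
          L = linForm ℓ<n α (tail x)
          L′ = linForm (s≤s ℓ<n) (fromℕ< k<p Vector.∷ α) x
          y = toℕ (head x)
          c = p ℕ.∸ t
          regroup : L ℕ.+ k ℕ.* (y ℕ.+ c) ≡ k ℕ.* y ℕ.+ L ℕ.+ k ℕ.* c
          regroup = solve 4 (λ L k y c → L :+ k :* (y :+ c) := k :* y :+ L :+ k :* c) refl L k y c
          L′≡ky+L : L′ ≡ k ℕ.* y ℕ.+ L
          L′≡ky+L = trans (linForm-∷ ℓ<n (fromℕ< k<p) α x) (cong (λ a → a ℕ.* y ℕ.+ L) (Fin.toℕ-fromℕ< k<p))

      sifted-product : ∀ x → 𝟙[ toℕ (head x) ≡ t ] * g (X x)
        ≡ ∑ p (λ u → g u * (p⁻¹ * (∑ p (λ k → 𝟙[ (X x ℕ.+ k ℕ.* d x) % p ≡ u ]) + 𝟙[ toℕ (head x) ≡ t ] - 1ℚ)))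
      sifted-product x = trans (sym (∑-sift p (X x) (λ u → 𝟙[ toℕ (head x) ≡ t ] * g u) (m%n<n _ p)))
        (∑-cong p λ u u<p → begin
          𝟙[ X x ≡ u ] * (𝟙[ toℕ (head x) ≡ t ] * g u) ≡⟨ rearrange 𝟙[ X x ≡ u ] 𝟙[ toℕ (head x) ≡ t ] (g u) ⟩
          g u * (𝟙[ X x ≡ u ] * 𝟙[ toℕ (head x) ≡ t ]) ≡⟨ cong (g u *_) (isolate _ 1ℚ _
                                                             (∑-𝟙-affine (m%n<n _ p) (Fin.toℕ<n (head x)) t<p u<p)) ⟩
          g u * (p⁻¹ * (∑ p (λ k → 𝟙[ (X x ℕ.+ k ℕ.* d x) % p ≡ u ]) + 𝟙[ toℕ (head x) ≡ t ] - 1ℚ)) ∎)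
        where
        open +-*-Solver
        rearrange : ∀ a b c → a * (b * c) ≡ c * (a * b)
        rearrange = solve 3 (λ a b c → a :* (b :* c) := c :* (a :* b)) refl

    span-𝟙-head*𝓕 : ∀ {n} (e : FElem p n) {t} → t < p → InSpan {suc n} (λ x → 𝟙[ toℕ (head x) ≡ t ] * evalF e (tail x))
    span-𝟙-head*𝓕 one                 {t} t<p = span-resp (λ x → ℚ.*-identityʳ 𝟙[ toℕ (head x) ≡ t ]) (span-𝟙-head t)
    span-𝟙-head*𝓕 (lin ℓ ℓ<n α β _) {t} t<p = span-resp
      (λ x → cong (λ r → 𝟙[ toℕ (head x) ≡ t ] * ℕ→ℚ r) (sym ([m%n+o]%n≡[m+o]%n (linForm ℓ<n α (tail x)) (toℕ β))))
      (span-𝟙-head*∘linForm ℓ<n α (λ w → ℕ→ℚ ((w ℕ.+ toℕ β) % p)) t<p)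

    span-𝟙-head* : ∀ {n} {g : Point p n → ℚ} {t} → t < p → InSpan g
                 → InSpan {suc n} (λ x → 𝟙[ toℕ (head x) ≡ t ] * g (tail x))
    span-𝟙-head* {n} {g} {t} t<p (L , g≡L) = span-resp (λ x → cong (𝟙[ toℕ (head x) ≡ t ] *_) (g≡L (tail x))) (combination L)
      where
      open +-*-Solver
      distrib : ∀ i c e r → i * (c * e + r) ≡ c * (i * e) + i * r
      distrib = solve 4 (λ i c e r → i :* (c :* e :+ r) := c :* (i :* e) :+ i :* r) refl
      combination : ∀ L → InSpan (λ x → 𝟙[ toℕ (head x) ≡ t ] * evalLC L (tail x))
      combination []            = span-resp (λ x → ℚ.*-zeroʳ 𝟙[ toℕ (head x) ≡ t ]) span-0
      combination ((c , e) ∷ L) = span-resp (λ x → distrib 𝟙[ toℕ (head x) ≡ t ] c (evalF e (tail x)) (evalLC L (tail x)))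
                                            (span-+ (span-scale c (span-𝟙-head*𝓕 e t<p)) (combination L))

    span-all : ∀ n (f : Point p n → ℚ) → f Preserves _≗_ ⟶ _≡_ → InSpan f
    span-all zero    f f-resp = span-resp (λ x → f-resp λ ()) (span-const (f λ ()))
    span-all (suc n) f f-resp = span-resp decompose
      (span-∑ p _ λ t t<p → span-𝟙-head* t<p (span-all n (f ∘ ((t mod p) Vector.∷_)) (λ eq → f-resp (cons-resp eq))))
      where
      cons-resp : ∀ {a} {x′ y′ : Point p n} → x′ ≗ y′ → (a Vector.∷ x′) ≗ (a Vector.∷ y′)
      cons-resp eq Fin.zero    = refl
      cons-resp eq (Fin.suc i) = eq i
      head-mod : ∀ (x : Point p (suc n)) → x ≗ ((toℕ (head x) mod p) Vector.∷ tail x)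
      head-mod x Fin.zero    = sym (Fin.toℕ-injective (trans (Fin.toℕ-fromℕ< _) (m<n⇒m%n≡m (Fin.toℕ<n (head x)))))
      head-mod x (Fin.suc i) = refl
      decompose : ∀ x → f x ≡ ∑ p (λ t → 𝟙[ toℕ (head x) ≡ t ] * f ((t mod p) Vector.∷ tail x))
      decompose x = trans (f-resp (head-mod x)) (sym (∑-sift p (toℕ (head x)) _ (Fin.toℕ<n (head x))))

lemma5p28 : (p : ℕ) → .{{_ : NonZero p}} → Prime p → (n d : ℕ) → (h : Fin d → PExpr p n)
    → ∃ λ (L : List (ℚ × FElem p n)) →
        (x : Point p n) → Πℚ d (λ i → evalP (h i) x) ≡ evalLC L x
lemma5p28 p p-prime n d h = span-all p-prime n (λ x → Πℚ d (λ i → evalP (h i) x))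
                                     (λ x≗y → Πℚ-cong d λ i → evalP-resp (h i) x≗y)
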